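{- Let $c$ and $q$ be positive integers and let $G$ be a $\mu$-bounded graph with parameter $c$. If the associated Hoffman graph $\mathfrak{g}(G,q)$ is a $2$-fat $\{\mathfrak{h}^{(3)},\mathfrak{d}\}$-line Hoffman graph, then any two distinct non-adjacent vertices of $G$ have at most $18$ common neighbours; and if moreover $G$ is regular, any two distinct non-adjacent vertices of $G$ have at most $12$ common neighbours.
   Context: $G$ is $\mu$-bounded with parameter $c$ if any two distinct non-adjacent vertices have at most $c$ common neighbours. A Hoffman graph $\mathfrak{h}=(H,\ell)$ is a graph $H$ with vertices labelled fat or slim, no two fat vertices adjacent, every fat vertex with a slim neighbour; it is $t$-fat if every slim vertex has at least $t$ fat neighbours. Special matrix: $S(\mathfrak{h})=A_{\rm slim}-M^TM$, with $A_{\rm slim}$ the adjacency matrix of the slim graph and $M$ the fat-by-slim $0/1$ adjacency matrix. Induced Hoffman subgraphs are induced subgraphs with inherited labels; the one generated by a set $W$ of slim vertices is induced on $W$ plus all fat vertices adjacent to a vertex of $W$. A decomposition of $\mathfrak{h}$ is a family $\{\mathfrak{h}^i\}$ generated by the parts of a partition of the slim vertices such that $S(\mathfrak{h})$ is block diagonal w.r.t. that partition. For a family $\mathfrak{G}$, $\mathfrak{h}$ is a $\mathfrak{G}$-line Hoffman graph if some Hoffman graph $\mathfrak{h}'$ with the same slim graph contains $\mathfrak{h}$ as induced Hoffman subgraph and has a decomposition whose members are each isomorphic to an induced Hoffman subgraph of a member of $\mathfrak{G}$. $\mathfrak{h}^{(3)}$: one slim vertex adjacent to three fat vertices; $\mathfrak{d}$: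 two adjacent slim vertices and two fat vertices, each fat adjacent to both slim vertices. The associated Hoffman graph $\mathfrak{g}(G,q)$ has slim graph $G$ and one fat vertex for each maximal clique of $G$ of order at least $q$, adjacent exactly to the vertices of that clique. -}

module Defs where

open import Data.Nat using (ℕ; zero; suc; _≤_; _≥_)
open import Data.Integer using (ℤ; _-_) renaming (+_ to ℤ+)
open import Data.Bool using (Bool; true; false; _∧_; _∨_; not; if_then_else_; T)
open import Data.Fin using (Fin; zero; suc; _≟_)
open import Data.Fin.Subset using (Subset; _∈_; _⊆_; ∣_∣)
open import Data.Vec using (tabulate)
open import Data.Product using (Σ; ∃; _×_; _,_)
open import Data.Sum using (_⊎_)
open import Relation.Nullary using (¬_; does)
open import Relation.Binary.PropositionalEquality using (_≡_; _≢_)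
open import Function.Bundles using (_⇔_)

record Graph (n : ℕ) : Set where
  field
    adj    : Fin n → Fin n → Bool
    sym    : ∀ x y → adj x y ≡ adj y x
    irrefl : ∀ x → adj x x ≡ false
open Graph public

commonNbrs : ∀ {n} → Graph n → Fin n → Fin n → Subset n
commonNbrs G u v = tabulate (λ w → adj G u w ∧ adj G v w)

MuBounded : ∀ {n} → Graph n → ℕ → Set
MuBounded G c = ∀ u v → u ≢ v → adj G u v ≡ false → ∣ commonNbrs G u v ∣ ≤ c

Regular : ∀ {n} → Graph n → Set
Regular {n} G = ∃ λ k → ∀ x → ∣ tabulate (adj G x) ∣ ≡ k

IsClique : ∀ {n} → Graph n → Subset n → Set
IsClique G C = ∀ x y → x ∈ C → y ∈ C → x ≢ y → adj G x y ≡ true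

IsMaximalClique : ∀ {n} → Graph n → Subset n → Set
IsMaximalClique G C = IsClique G C × (∀ D → IsClique G D → C ⊆ D → D ≡ C)

-- fat vertices of the associated Hoffman graph g(G,q):
-- maximal cliques of order at least q
IsFatClique : ∀ {n} → Graph n → ℕ → Subset n → Set
IsFatClique G q C = IsMaximalClique G C × ∣ C ∣ ≥ q

-- Hoffman graphs with slim vertices Fin s and fat vertices Fin fat.
-- (Fat vertices are never adjacent to each other by construction.)

anyFin : ∀ {n} → (Fin n → Bool) → Bool
anyFin {zero}  p = false
anyFin {suc n} p = p zero ∨ anyFin (λ i → p (suc i))

record Hoffman (s : ℕ) : Set where
  field
    fat        : ℕ
    slimAdj    : Fin s → Fin s → Bool
    slimSym    : ∀ x y → slimAdj x y ≡ slimAdj y x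
    slimIrrefl : ∀ x → slimAdj x x ≡ false
    fatAdj     : Fin fat → Fin s → Bool
    fatHasSlim : ∀ F → ∃ λ x → fatAdj F x ≡ true
open Hoffman public

b2ℤ : Bool → ℤ
b2ℤ true  = ℤ+ 1
b2ℤ false = ℤ+ 0

-- special matrix S(h) = A_slim - MᵀM
special : ∀ {s} (h : Hoffman s) → Fin s → Fin s → ℤ
special h x y = b2ℤ (slimAdj h x y) - ℤ+ ∣ tabulate (λ F → fatAdj h F x ∧ fatAdj h F y) ∣

h3 : Hoffman 1
h3 = record
  { fat = 3 ; slimAdj = λ _ _ → false ; slimSym = λ _ _ → _≡_.refl
  ; slimIrrefl = λ _ → _≡_.refl ; fatAdj = λ _ _ → true
  ; fatHasSlim = λ _ → zero , _≡_.refl }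

dHoff : Hoffman 2
dHoff = record
  { fat = 2 ; slimAdj = λ x y → not (does (x ≟ y))
  ; slimSym = symP ; slimIrrefl = irr
  ; fatAdj = λ _ _ → true ; fatHasSlim = λ _ → zero , _≡_.refl }
  where
  symP : ∀ (x y : Fin 2) → not (does (x ≟ y)) ≡ not (does (y ≟ x))
  symP zero zero = _≡_.refl
  symP zero (suc zero) = _≡_.refl
  symP (suc zero) zero = _≡_.refl
  symP (suc zero) (suc zero) = _≡_.refl
  irr : ∀ (x : Fin 2) → not (does (x ≟ x)) ≡ false
  irr zero = _≡_.refl
  irr (suc zero) = _≡_.refl

-- The induced Hoffman subgraph of h generated by the slim vertices
-- satisfying P (slim vertices in P, plus all fat vertices with a neighbour
-- in P) is isomorphic to an induced Hoffman subgraph of t, i.e. it admits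
-- an induced embedding into t.
InSlim : ∀ {s} → (Fin s → Bool) → Fin s → Set
InSlim P x = T (P x)

InFat : ∀ {s} (h : Hoffman s) → (Fin s → Bool) → Fin (fat h) → Set
InFat h P F = T (anyFin (λ x → P x ∧ fatAdj h F x))

record GeneratedEmbeds {s t} (h : Hoffman s) (P : Fin s → Bool) (k : Hoffman t) : Set where
  field
    σ       : (x : Fin s) → InSlim P x → Fin t
    φ       : (F : Fin (fat h)) → InFat h P F → Fin (fat k)
    σ-inj   : ∀ x y px py → σ x px ≡ σ y py → x ≡ y
    φ-inj   : ∀ F G pF pG → φ F pF ≡ φ G pG → F ≡ G
    σ-slim  : ∀ x y px py → slimAdj h x y ≡ slimAdj k (σ x px) (σ y py)
    σφ-fat  : ∀ F x pF px → fatAdj h F x ≡ fatAdj k (φ F pF) (σ x px)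

-- a decomposition of h, partition given by the labelling `part`,
-- whose members are each isomorphic to an induced Hoffman subgraph of
-- h^(3) or 𝔡
record H3DDecomposition {s} (h : Hoffman s) : Set where
  field
    parts     : ℕ
    part      : Fin s → Fin parts
    blockDiag : ∀ x y → part x ≢ part y → special h x y ≡ ℤ+ 0
    members   : ∀ i → GeneratedEmbeds h (λ x → does (part x ≟ i)) h3
                    ⊎ GeneratedEmbeds h (λ x → does (part x ≟ i)) dHoff

-- g(G,q) is a {h^(3), 𝔡}-line Hoffman graph: there is a Hoffman graph h'
-- with the same slim graph G containing g(G,q) as induced Hoffman subgraph
-- (slim vertices identified, fat vertices = fat cliques embedded
-- injectively with the same neighbourhoods) and admitting such a
-- decomposition.
AssocIsH3DLine : ∀ {n} → Graph n → ℕ → Set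
AssocIsH3DLine {n} G q =
  Σ (Hoffman n) λ h' →
    (∀ x y → slimAdj h' x y ≡ adj G x y) ×
    (Σ ((C : Subset n) → IsFatClique G q C → Fin (fat h')) λ φ →
        (∀ C p p' → φ C p ≡ φ C p') ×
        (∀ C D p p' → φ C p ≡ φ D p' → C ≡ D) ×
        (∀ C p x → (x ∈ C) ⇔ (fatAdj h' (φ C p) x ≡ true))) ×
    H3DDecomposition h'

AssocIs2Fat : ∀ {n} → Graph n → ℕ → Set
AssocIs2Fat {n} G q = ∀ x → Σ (Subset n) λ C → Σ (Subset n) λ D →
  C ≢ D × IsFatClique G q C × IsFatClique G q D × x ∈ C × x ∈ D

{-# OPTIONS --safe #-}
-- Let 𝔥 be the Hoffman graph with slim graph G that contains 𝔤(G,q) and has a decomposition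
-- into induced subgraphs of 𝔥⁽³⁾ and 𝔡.  Block-diagonality of the special matrix says that slim
-- vertices in different parts share exactly one fat neighbour when adjacent and none otherwise,
-- while slim vertices in the same part are adjacent and have the same fat neighbours.  Hence
-- non-adjacent u and v lie in different parts and share no fat neighbour, and every common
-- neighbour w shares a unique fat vertex with u and a unique one with v.  Put w in the cell given
-- by this pair of fat vertices: two common neighbours in the same cell share two fat vertices, so
-- they lie in the same part and are told apart by their position in it.  As u and v have at most
-- three fat neighbours each, there are at most 3 · 3 · 2 = 18 common neighbours.
--
-- Now let G be k-regular.  A vertex sharing its part with another vertex lies in a copy of 𝔡 and
-- has at most two fat neighbours; if u or v is such a vertex, the count is 2 · 3 · 2 = 12.
-- Otherwise call a cell (A, B) heavy when some vertex sharing its part lies under both A and B.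
-- Writing |A| for the number of slim neighbours of a fat vertex A, counting neighbourhoods gives
-- |A| + |B| ≥ k + 3 for a heavy cell and |A| + |A'| ≤ k + 2 for distinct fat neighbours A, A' of u
-- (and likewise for v), so any two heavy cells share a row or a column.  Then all heavy cells lie
-- in one row or one column, and only heavy cells can hold two common neighbours: 3 · 2 + 2 · 3 = 12.
module Submission where

open import Defs hiding (sym)
open import Axiom.UniquenessOfIdentityProofs using (module Decidable⇒UIP)
open import Data.Bool using (Bool; true; false; _∧_; not; T)
open import Data.Bool.Properties using (∧-conicalˡ; ∧-conicalʳ; T-≡; T-∨; T-irrelevant)
  renaming (_≟_ to _≟ᵇ_)
open import Data.Empty using (⊥; ⊥-elim)
open import Data.Fin using (Fin; zero; suc; _≟_; punchOut; combine; join; splitAt; inject₁; inject≤)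
open import Data.Fin.Properties
  using (suc-injective; 0≢1+n; punchOut-injective; combine-injective; splitAt-join; inject₁-injective;
         inject≤-injective; any?)
open import Data.Fin.Subset using (Subset; inside; outside; _∈_; _⊆_; _⊂_; _∪_; _∩_; ∣_∣; ⁅_⁆; Nonempty)
open import Data.Fin.Subset.Properties
  using (x∈p⇒∣p-x∣<∣p∣; x∈p∧x≢y⇒x∈p-y; nonempty?; Empty-unique; ∣⊥∣≡0; p⊆q⇒∣p∣≤∣q∣; p⊂q⇒∣p∣<∣q∣;
         ∣⁅x⁆∣≡1; x∈⁅x⁆; x∈⁅y⁆⇔x≡y; x∈p∪q⁺; x∈p∪q⁻; x∈p∩q⁺; x∈p∩q⁻)
open import Data.Integer using () renaming (+_ to ℤ+)
open import Data.Integer.Properties using (i-j≡0⇒i≡j; +-injective)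
open import Data.Nat using (ℕ; zero; suc; _+_; _*_; _≤_; _<_; _≥_; z≤n; s≤s)
open import Data.Nat.Properties
  using (+-suc; +-assoc; ≤-trans; ≤-reflexive; <⇒≢; <⇒≱; m≤m+n; <-irrefl; n<1+n; +-mono-<; +-monoʳ-<;
         +-mono-≤; +-monoˡ-≤; +-commutativeSemigroup; module ≤-Reasoning)
open import Algebra.Properties.CommutativeSemigroup +-commutativeSemigroup using (interchange)
open import Data.Product using (∃-syntax; _×_; _,_; proj₁; proj₂)
open import Data.Sum using (_⊎_; inj₁; inj₂; [_,_]′)
open import Data.Sum.Properties using (inj₁-injective; inj₂-injective)
open import Data.Vec using (_∷_; []; tabulate)
open import Data.Vec.Base using (here; there)
open import Data.Vec.Properties using (lookup∘tabulate; []=⇒lookup; lookup⇒[]=; tabulate-cong)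
open import Function using (_∘_; _$_; id)
open import Function.Bundles using (Equivalence)
open import Relation.Nullary using (Dec; yes; no; ¬_; ¬?; does; contradiction)
open import Relation.Nullary.Decidable using (dec-true; dec-false; decidable-stable; _×-dec_)
open import Relation.Binary.PropositionalEquality using (_≡_; _≢_; refl; sym; trans; cong; cong₂; subst)

-- Counting elements of finite subsets

module _ {n} {p : Fin n → Bool} {x : Fin n} where

  ∈-tabulate⁺ : p x ≡ true → x ∈ tabulate p
  ∈-tabulate⁺ px = lookup⇒[]= x (tabulate p) (trans (lookup∘tabulate p x) px)

  ∈-tabulate⁻ : x ∈ tabulate p → p x ≡ true
  ∈-tabulate⁻ x∈p = trans (sym (lookup∘tabulate p x)) ([]=⇒lookup x∈p)

module _ {n} {p q : Fin n → Bool} {x : Fin n} where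

  ∈-tabulate-∧⁺ : p x ≡ true → q x ≡ true → x ∈ tabulate (λ y → p y ∧ q y)
  ∈-tabulate-∧⁺ px qx = ∈-tabulate⁺ (cong₂ _∧_ px qx)

  ∈-tabulate-∧⁻ : x ∈ tabulate (λ y → p y ∧ q y) → p x ≡ true × q x ≡ true
  ∈-tabulate-∧⁻ x∈pq = ∧-conicalˡ _ _ pxqx , ∧-conicalʳ _ _ pxqx
    where pxqx = ∈-tabulate⁻ x∈pq

∣p∪q∣+∣p∩q∣≡∣p∣+∣q∣ : ∀ {n} (p q : Subset n) → ∣ p ∪ q ∣ + ∣ p ∩ q ∣ ≡ ∣ p ∣ + ∣ q ∣
∣p∪q∣+∣p∩q∣≡∣p∣+∣q∣ []            []            = refl
∣p∪q∣+∣p∩q∣≡∣p∣+∣q∣ (inside  ∷ p) (inside  ∷ q) =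
  cong suc (trans (+-suc _ _) (trans (cong suc (∣p∪q∣+∣p∩q∣≡∣p∣+∣q∣ p q)) (sym (+-suc _ _))))
∣p∪q∣+∣p∩q∣≡∣p∣+∣q∣ (inside  ∷ p) (outside ∷ q) = cong suc (∣p∪q∣+∣p∩q∣≡∣p∣+∣q∣ p q)
∣p∪q∣+∣p∩q∣≡∣p∣+∣q∣ (outside ∷ p) (inside  ∷ q) =
  trans (cong suc (∣p∪q∣+∣p∩q∣≡∣p∣+∣q∣ p q)) (sym (+-suc _ _))
∣p∪q∣+∣p∩q∣≡∣p∣+∣q∣ (outside ∷ p) (outside ∷ q) = ∣p∪q∣+∣p∩q∣≡∣p∣+∣q∣ p q

∣p∪q∣≤∣p∣+∣q∣ : ∀ {n} (p q : Subset n) → ∣ p ∪ q ∣ ≤ ∣ p ∣ + ∣ q ∣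
∣p∪q∣≤∣p∣+∣q∣ p q = ≤-trans (m≤m+n _ _) (≤-reflexive (∣p∪q∣+∣p∩q∣≡∣p∣+∣q∣ p q))

x∈p⇒0<∣p∣ : ∀ {n} {p : Subset n} {x} → x ∈ p → 0 < ∣ p ∣
x∈p⇒0<∣p∣ x∈p = ≤-trans (s≤s z≤n) (x∈p⇒∣p-x∣<∣p∣ x∈p)

x,y∈p⇒1<∣p∣ : ∀ {n} {p : Subset n} {x y} → x ∈ p → y ∈ p → x ≢ y → 1 < ∣ p ∣
x,y∈p⇒1<∣p∣ x∈p y∈p x≢y =
  ≤-trans (s≤s (x∈p⇒0<∣p∣ (x∈p∧x≢y⇒x∈p-y y∈p (x≢y ∘ sym)))) (x∈p⇒∣p-x∣<∣p∣ x∈p)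

0<∣p∣⇒Nonempty : ∀ {n} {p : Subset n} → 0 < ∣ p ∣ → Nonempty p
0<∣p∣⇒Nonempty {n} {p} 0<∣p∣ with nonempty? p
... | yes p≠∅ = p≠∅
... | no  p=∅ = contradiction (trans (cong ∣_∣ (Empty-unique p=∅)) (∣⊥∣≡0 n)) (<⇒≢ 0<∣p∣ ∘ sym)

injective⇒∣p∣≤ : ∀ {n m} {p : Subset n} (f : ∀ {x} → x ∈ p → Fin m) →
                 (∀ {x y} (x∈p : x ∈ p) (y∈p : y ∈ p) → f x∈p ≡ f y∈p → x ≡ y) → ∣ p ∣ ≤ m
injective⇒∣p∣≤ {p = []} f f-inj = z≤n
injective⇒∣p∣≤ {p = outside ∷ p} f f-inj =
  injective⇒∣p∣≤ (λ x∈p → f (there x∈p)) (λ x∈p y∈p → suc-injective ∘ f-inj (there x∈p) (there y∈p))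
injective⇒∣p∣≤ {m = zero}  {p = inside ∷ p} f f-inj with () ← f here
injective⇒∣p∣≤ {m = suc m} {p = inside ∷ p} f f-inj = s≤s (injective⇒∣p∣≤ g g-inj)
  where
  f₀≢f : ∀ {x} (x∈p : x ∈ p) → f here ≢ f (there x∈p)
  f₀≢f x∈p = 0≢1+n ∘ f-inj here (there x∈p)

  g : ∀ {x} → x ∈ p → Fin m
  g x∈p = punchOut (f₀≢f x∈p)

  g-inj : ∀ {x y} (x∈p : x ∈ p) (y∈p : y ∈ p) → g x∈p ≡ g y∈p → x ≡ y
  g-inj x∈p y∈p =
    suc-injective ∘ f-inj (there x∈p) (there y∈p) ∘ punchOut-injective (f₀≢f x∈p) (f₀≢f y∈p)

-- (a, b) places the elements of S in the cells of a k × l grid, and c separates the elements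
-- sharing a cell.
CellInjective : ∀ {n k l m} {S : Subset n} →
                (∀ {w} → w ∈ S → Fin k) → (∀ {w} → w ∈ S → Fin l) → (Fin n → Fin m) → Set
CellInjective {S = S} a b c = ∀ {w w'} (w∈S : w ∈ S) (w'∈S : w' ∈ S) →
  a w∈S ≡ a w'∈S → b w∈S ≡ b w'∈S → c w ≡ c w' → w ≡ w'

module _ {n k l m} {S : Subset n} {a : ∀ {w} → w ∈ S → Fin k} {b : ∀ {w} → w ∈ S → Fin l}
         {c : Fin n → Fin m} (cell-inj : CellInjective a b c) where

  CellInjective-swap : CellInjective b a c
  CellInjective-swap w∈S w'∈S b≡ a≡ = cell-inj w∈S w'∈S a≡ b≡

  cellInjective⇒∣S∣≤ : ∣ S ∣ ≤ k * l * m
  cellInjective⇒∣S∣≤ = injective⇒∣p∣≤ code code-inj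
    where
    code : ∀ {w} → w ∈ S → Fin (k * l * m)
    code {w} w∈S = combine (combine (a w∈S) (b w∈S)) (c w)

    code-inj : ∀ {w w'} (w∈S : w ∈ S) (w'∈S : w' ∈ S) → code w∈S ≡ code w'∈S → w ≡ w'
    code-inj w∈S w'∈S eq =
      let ab≡ , c≡ = combine-injective _ _ _ _ eq
          a≡ , b≡  = combine-injective _ _ _ _ ab≡
      in cell-inj w∈S w'∈S a≡ b≡ c≡

module _ {n k l m} {S : Subset n} {a : ∀ {w} → w ∈ S → Fin (suc k)} {b : ∀ {w} → w ∈ S → Fin l}
         {c : Fin n → Fin m} (cell-inj : CellInjective a b c) where

  -- Cells outside row i₀ hold at most one element each, whence the bound l · m + k · l.
  cellInjective⇒∣S∣≤-oneFullRow : (i₀ : Fin (suc k)) →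
    (∀ {w w'} (w∈S : w ∈ S) (w'∈S : w' ∈ S) → w ≢ w' → a w∈S ≡ a w'∈S → b w∈S ≡ b w'∈S → a w∈S ≡ i₀) →
    ∣ S ∣ ≤ l * m + k * l
  cellInjective⇒∣S∣≤-oneFullRow i₀ full = injective⇒∣p∣≤ code code-inj
    where
    split : ∀ {w} (w∈S : w ∈ S) → Dec (a w∈S ≡ i₀) → Fin (l * m) ⊎ Fin (k * l)
    split {w} w∈S (yes _)   = inj₁ (combine (b w∈S) (c w))
    split     w∈S (no a≢i₀) = inj₂ (combine (punchOut (a≢i₀ ∘ sym)) (b w∈S))

    split-inj : ∀ {w w'} (w∈S : w ∈ S) (w'∈S : w' ∈ S) d d' → split w∈S d ≡ split w'∈S d' → w ≡ w'
    split-inj w∈S w'∈S (yes a≡i₀) (yes a'≡i₀) eq =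
      let b≡ , c≡ = combine-injective _ _ _ _ (inj₁-injective eq)
      in cell-inj w∈S w'∈S (trans a≡i₀ (sym a'≡i₀)) b≡ c≡
    split-inj {w} {w'} w∈S w'∈S (no a≢i₀) (no a'≢i₀) eq with w ≟ w'
    ... | yes w≡w' = w≡w'
    ... | no  w≢w' =
      let a≡ , b≡ = combine-injective _ _ _ _ (inj₂-injective eq)
      in contradiction (full w∈S w'∈S w≢w' (punchOut-injective (a≢i₀ ∘ sym) (a'≢i₀ ∘ sym) a≡) b≡) a≢i₀

    code : ∀ {w} → w ∈ S → Fin (l * m + k * l)
    code w∈S = join _ _ (split w∈S (a w∈S ≟ i₀))

    code-inj : ∀ {w w'} (w∈S : w ∈ S) (w'∈S : w' ∈ S) → code w∈S ≡ code w'∈S → w ≡ w'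
    code-inj w∈S w'∈S eq = split-inj w∈S w'∈S (a w∈S ≟ i₀) (a w'∈S ≟ i₀)
      (trans (sym (splitAt-join _ _ _)) (trans (cong (splitAt (l * m)) eq) (splitAt-join _ _ _)))

module _ {k l} {R : Fin k → Fin l → Set} where

  Meeting SharedRow SharedColumn : Set
  Meeting      = ∀ {i j i' j'} → R i j → R i' j' → i ≡ i' ⊎ j ≡ j'
  SharedRow    = ∀ {i j i' j'} → R i j → R i' j' → i ≡ i'
  SharedColumn = ∀ {i j i' j'} → R i j → R i' j' → j ≡ j'

  meeting⇒sharedRow⊎sharedColumn : (∀ i j → Dec (R i j)) → Meeting → SharedRow ⊎ SharedColumn
  meeting⇒sharedRow⊎sharedColumn R? meet
    with any? (λ i → any? λ j → any? λ i' → any? λ j' → R? i j ×-dec R? i' j' ×-dec ¬? (i ≟ i'))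
  ... | no ∄ = inj₁ λ {i} {j} {i'} {j'} r r' →
    decidable-stable (i ≟ i') λ i≢i' → ∄ (i , j , i' , j' , r , r' , i≢i')
  ... | yes (i₁ , j₁ , i₂ , j₂ , r₁ , r₂ , i₁≢i₂) = inj₂ λ r r' → trans (inColumn r) (sym (inColumn r'))
    where
    sameColumn : ∀ {i j i' j'} → i ≢ i' → R i j → R i' j' → j ≡ j'
    sameColumn i≢i' r r' = [ (λ i≡i' → contradiction i≡i' i≢i') , id ]′ (meet r r')

    inColumn : ∀ {i j} → R i j → j ≡ j₁
    inColumn {i} r with i ≟ i₁
    ... | no  i≢i₁ = sameColumn i≢i₁ r r₁
    ... | yes refl = trans (sameColumn i₁≢i₂ r r₂) (sym (sameColumn i₁≢i₂ r₁ r₂))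

crossSums-contradiction : ∀ {k} α β α' β' → k + 3 ≤ α + β → k + 3 ≤ α' + β' →
                          α + α' ≤ k + 2 → β + β' ≤ k + 2 → ⊥
crossSums-contradiction {k} α β α' β' αβ α'β' αα' ββ' = <-irrefl refl $ begin-strict
  (k + 2) + (k + 2)    <⟨ +-mono-< (+-monoʳ-< k (n<1+n 2)) (+-monoʳ-< k (n<1+n 2)) ⟩
  (k + 3) + (k + 3)    ≤⟨ +-mono-≤ αβ α'β' ⟩
  (α + β) + (α' + β')  ≡⟨ interchange α β α' β' ⟩
  (α + α') + (β + β')  ≤⟨ +-mono-≤ αα' ββ' ⟩
  (k + 2) + (k + 2)    ∎
  where open ≤-Reasoning

-- Hoffman graphs with an {𝔥⁽³⁾, 𝔡}-decomposition

module _ {s} (h : Hoffman s) where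

  slimNbrs : Fin s → Subset s
  slimNbrs x = tabulate (slimAdj h x)

  degree : Fin s → ℕ
  degree x = ∣ slimNbrs x ∣

  commonSlimNbrs : Fin s → Fin s → Subset s
  commonSlimNbrs x y = tabulate λ z → slimAdj h x z ∧ slimAdj h y z

  fatNbrs : Fin (fat h) → Subset s
  fatNbrs F = tabulate (fatAdj h F)

  commonFat : Fin s → Fin s → Subset (fat h)
  commonFat x y = tabulate λ F → fatAdj h F x ∧ fatAdj h F y

  module _ {x y : Fin s} {F : Fin (fat h)} where

    ∈commonFat⁺ : fatAdj h F x ≡ true → fatAdj h F y ≡ true → F ∈ commonFat x y
    ∈commonFat⁺ = ∈-tabulate-∧⁺ {p = λ F → fatAdj h F x} {q = λ F → fatAdj h F y}

    ∈commonFat⁻ : F ∈ commonFat x y → fatAdj h F x ≡ true × fatAdj h F y ≡ true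
    ∈commonFat⁻ = ∈-tabulate-∧⁻ {p = λ F → fatAdj h F x} {q = λ F → fatAdj h F y}

record FatIndexing {s} (h : Hoffman s) (x : Fin s) (m : ℕ) : Set where
  field
    index           : ∀ {F} → fatAdj h F x ≡ true → Fin m
    index-injective : ∀ {F F'} (Fx : fatAdj h F x ≡ true) (F'x : fatAdj h F' x ≡ true) →
                      index Fx ≡ index F'x → F ≡ F'

  index-cong : ∀ {F F'} → F ≡ F' → (Fx : fatAdj h F x ≡ true) (F'x : fatAdj h F' x ≡ true) →
               index Fx ≡ index F'x
  index-cong refl Fx F'x = cong index (Decidable⇒UIP.≡-irrelevant _≟ᵇ_ Fx F'x)

  weaken : ∀ {m'} → m ≤ m' → FatIndexing h x m'
  weaken m≤m' = record
    { index           = λ Fx → inject≤ (index Fx) m≤m'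
    ; index-injective = λ Fx F'x → index-injective Fx F'x ∘ inject≤-injective m≤m' m≤m' _ _
    }

open FatIndexing using (index; index-injective; index-cong)

i≢j⇒k≡i⊎k≡j : ∀ {i j k : Fin 2} → i ≢ j → k ≡ i ⊎ k ≡ j
i≢j⇒k≡i⊎k≡j {zero}     {zero}                i≢j = contradiction refl i≢j
i≢j⇒k≡i⊎k≡j {suc zero} {suc zero}            i≢j = contradiction refl i≢j
i≢j⇒k≡i⊎k≡j {zero}     {suc zero} {zero}     _   = inj₁ refl
i≢j⇒k≡i⊎k≡j {zero}     {suc zero} {suc zero} _   = inj₂ refl
i≢j⇒k≡i⊎k≡j {suc zero} {zero}     {zero}     _   = inj₂ refl
i≢j⇒k≡i⊎k≡j {suc zero} {zero}     {suc zero} _   = inj₁ refl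

fatIndexing₂⇒≡⊎≡ : ∀ {s} {h : Hoffman s} {x F F' G} → FatIndexing h x 2 → F ≢ F' →
                    fatAdj h F x ≡ true → fatAdj h F' x ≡ true → fatAdj h G x ≡ true → G ≡ F ⊎ G ≡ F'
fatIndexing₂⇒≡⊎≡ I F≢F' Fx F'x Gx
  with i≢j⇒k≡i⊎k≡j {k = index I Gx} (F≢F' ∘ index-injective I Fx F'x)
... | inj₁ G≡F  = inj₁ (index-injective I Gx Fx G≡F)
... | inj₂ G≡F' = inj₂ (index-injective I Gx F'x G≡F')

fin1-unique : ∀ (i j : Fin 1) → i ≡ j
fin1-unique zero zero = refl

anyFin-intro : ∀ {m} (p : Fin m → Bool) {i} → p i ≡ true → T (anyFin p)
anyFin-intro p {zero}  pi = Equivalence.from T-∨ (inj₁ (Equivalence.from T-≡ pi))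
anyFin-intro p {suc i} pi = Equivalence.from T-∨ (inj₂ (anyFin-intro (p ∘ suc) pi))

module Embedding {s t} {h : Hoffman s} {P : Fin s → Bool} {k : Hoffman t}
                 (e : GeneratedEmbeds h P k) where
  open GeneratedEmbeds e

  inGeneratedFat : ∀ {x F} → InSlim P x → fatAdj h F x ≡ true → InFat h P F
  inGeneratedFat {x} {F} x∈P Fx =
    anyFin-intro (λ y → P y ∧ fatAdj h F y) (cong₂ _∧_ (Equivalence.to T-≡ x∈P) Fx)

  fatIndexing : ∀ {x} → InSlim P x → FatIndexing h x (fat k)
  fatIndexing x∈P = record
    { index           = λ Fx → φ _ (inGeneratedFat x∈P Fx)
    ; index-injective = λ _ _ → φ-inj _ _ _ _
    }

  sharedFat : (∀ F x → fatAdj k F x ≡ true) → ∀ {x y F} → InSlim P x → InSlim P y →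
              fatAdj h F y ≡ true → fatAdj h F x ≡ true
  sharedFat complete {x} {F = F} x∈P y∈P Fy =
    trans (σφ-fat F x (inGeneratedFat y∈P Fy) x∈P) (complete _ _)

module Decomposition {s} {h : Hoffman s} (D : H3DDecomposition h) where
  open H3DDecomposition D

  InPart : Fin parts → Fin s → Bool
  InPart i x = does (part x ≟ i)

  Member : Fin parts → Set
  Member i = GeneratedEmbeds h (InPart i) h3 ⊎ GeneratedEmbeds h (InPart i) dHoff

  inPart : ∀ {x i} → part x ≡ i → InSlim (InPart i) x
  inPart {x} {i} part≡i = Equivalence.from T-≡ (dec-true (part x ≟ i) part≡i)

  Partnered : Fin s → Set
  Partnered x = ∃[ y ] (y ≢ x × part y ≡ part x)

  partnered? : ∀ x → Dec (Partnered x)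
  partnered? x = any? λ y → ¬? (y ≟ x) ×-dec (part y ≟ part x)

  module _ {i : Fin parts} where

    member-fatAdj : Member i → ∀ {x y F} → InSlim (InPart i) x → InSlim (InPart i) y →
                    fatAdj h F y ≡ true → fatAdj h F x ≡ true
    member-fatAdj (inj₁ e) = Embedding.sharedFat e λ _ _ → refl
    member-fatAdj (inj₂ e) = Embedding.sharedFat e λ _ _ → refl

    h3-singleton : (e : GeneratedEmbeds h (InPart i) h3) → ∀ {x y} →
                   InSlim (InPart i) x → InSlim (InPart i) y → x ≡ y
    h3-singleton e x∈i y∈i = GeneratedEmbeds.σ-inj e _ _ x∈i y∈i (fin1-unique _ _)

    member-adjacent : Member i → ∀ {x y} → InSlim (InPart i) x → InSlim (InPart i) y →
                      x ≢ y → slimAdj h x y ≡ true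
    member-adjacent (inj₁ e) x∈i y∈i x≢y = contradiction (h3-singleton e x∈i y∈i) x≢y
    member-adjacent (inj₂ e) {x} {y} x∈i y∈i x≢y =
      trans (σ-slim x y x∈i y∈i) (cong not (dec-false (σ x x∈i ≟ σ y y∈i) (x≢y ∘ σ-inj x y x∈i y∈i)))
      where open GeneratedEmbeds e

    slotIn : Member i → ∀ {x} → InSlim (InPart i) x → Fin 2
    slotIn (inj₁ e) x∈i = inject₁ (GeneratedEmbeds.σ e _ x∈i)
    slotIn (inj₂ e) x∈i = GeneratedEmbeds.σ e _ x∈i

    slotIn-injective : (m : Member i) → ∀ {x y} (x∈i : InSlim (InPart i) x) (y∈i : InSlim (InPart i) y) →
                       slotIn m x∈i ≡ slotIn m y∈i → x ≡ y
    slotIn-injective (inj₁ e) x∈i y∈i = GeneratedEmbeds.σ-inj e _ _ x∈i y∈i ∘ inject₁-injective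
    slotIn-injective (inj₂ e) x∈i y∈i = GeneratedEmbeds.σ-inj e _ _ x∈i y∈i

    member-fatIndexing₃ : Member i → ∀ {x} → InSlim (InPart i) x → FatIndexing h x 3
    member-fatIndexing₃ (inj₁ e) x∈i = Embedding.fatIndexing e x∈i
    member-fatIndexing₃ (inj₂ e) x∈i = FatIndexing.weaken (Embedding.fatIndexing e x∈i) (s≤s (s≤s z≤n))

    member-fatIndexing₂ : Member i → ∀ {x y} → InSlim (InPart i) x → InSlim (InPart i) y →
                          y ≢ x → FatIndexing h x 2
    member-fatIndexing₂ (inj₁ e) x∈i y∈i y≢x = contradiction (h3-singleton e y∈i x∈i) y≢x
    member-fatIndexing₂ (inj₂ e) x∈i _   _   = Embedding.fatIndexing e x∈i

  samePart⇒fatAdj : ∀ {x y F} → part x ≡ part y → fatAdj h F y ≡ true → fatAdj h F x ≡ true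
  samePart⇒fatAdj {x} x≈y = member-fatAdj (members (part x)) (inPart refl) (inPart (sym x≈y))

  samePart⇒adjacent : ∀ {x y} → part x ≡ part y → x ≢ y → slimAdj h x y ≡ true
  samePart⇒adjacent {x} x≈y = member-adjacent (members (part x)) (inPart refl) (inPart (sym x≈y))

  fatIndexing₃ : ∀ x → FatIndexing h x 3
  fatIndexing₃ x = member-fatIndexing₃ (members (part x)) (inPart refl)

  partnered⇒fatIndexing₂ : ∀ {x} → Partnered x → FatIndexing h x 2
  partnered⇒fatIndexing₂ {x} (y , y≢x , y≈x) =
    member-fatIndexing₂ (members (part x)) (inPart refl) (inPart y≈x) y≢x

  slot : Fin s → Fin 2
  slot x = slotIn (members (part x)) (inPart refl)

  slot-injective : ∀ {x y} → part x ≡ part y → slot x ≡ slot y → x ≡ y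
  slot-injective {x} {y} x≈y sx≡sy =
    slotIn-injective (members (part x)) (inPart refl) (inPart (sym x≈y)) (trans sx≡sy (slotIn-cong x≈y))
    where
    slotIn-cong : ∀ {i j} → i ≡ j → {y∈j : InSlim (InPart j) y} {y∈i : InSlim (InPart i) y} →
                  slotIn (members j) y∈j ≡ slotIn (members i) y∈i
    slotIn-cong refl = cong (slotIn (members _)) (T-irrelevant _ _)

  apart⇒∣commonFat∣≡slimAdj : ∀ {x y} → part x ≢ part y → ℤ+ ∣ commonFat h x y ∣ ≡ b2ℤ (slimAdj h x y)
  apart⇒∣commonFat∣≡slimAdj {x} {y} x≉y = sym (i-j≡0⇒i≡j _ _ (blockDiag x y x≉y))

  apart-nonadjacent⇒noCommonFat : ∀ {x y F} → part x ≢ part y → slimAdj h x y ≡ false →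
                                  fatAdj h F x ≡ true → fatAdj h F y ≡ true → ⊥
  apart-nonadjacent⇒noCommonFat x≉y x≁y Fx Fy = <⇒≢ (x∈p⇒0<∣p∣ (∈commonFat⁺ h Fx Fy))
    (sym (+-injective (trans (apart⇒∣commonFat∣≡slimAdj x≉y) (cong b2ℤ x≁y))))

  apart-adjacent⇒commonFat : ∀ {x y} → part x ≢ part y → slimAdj h x y ≡ true →
                             ∃[ F ] (fatAdj h F x ≡ true × fatAdj h F y ≡ true)
  apart-adjacent⇒commonFat {x} {y} x≉y x∼y =
    let F , F∈ = 0<∣p∣⇒Nonempty {p = commonFat h x y} (≤-reflexive (sym (+-injective
                   (trans (apart⇒∣commonFat∣≡slimAdj x≉y) (cong b2ℤ x∼y)))))
    in F , ∈commonFat⁻ h F∈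

  apart-commonFat⇒adjacent : ∀ {x y F} → part x ≢ part y →
                             fatAdj h F x ≡ true → fatAdj h F y ≡ true → slimAdj h x y ≡ true
  apart-commonFat⇒adjacent {x} {y} x≉y Fx Fy with slimAdj h x y in x≁y
  ... | true  = refl
  ... | false = ⊥-elim (apart-nonadjacent⇒noCommonFat x≉y x≁y Fx Fy)

  ∣commonFat∣≤1 : ∀ {x y} → part x ≢ part y → ∣ commonFat h x y ∣ ≤ 1
  ∣commonFat∣≤1 {x} {y} x≉y with slimAdj h x y | apart⇒∣commonFat∣≡slimAdj x≉y
  ... | true  | eq = ≤-reflexive (+-injective eq)
  ... | false | eq = ≤-trans (≤-reflexive (+-injective eq)) z≤n

  twoCommonFat⇒samePart : ∀ {x y F F'} → F ≢ F' → fatAdj h F x ≡ true → fatAdj h F y ≡ true →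
                          fatAdj h F' x ≡ true → fatAdj h F' y ≡ true → part x ≡ part y
  twoCommonFat⇒samePart {x} {y} F≢F' Fx Fy F'x F'y = decidable-stable (part x ≟ part y) λ x≉y →
    <⇒≱ (x,y∈p⇒1<∣p∣ (∈commonFat⁺ h Fx Fy) (∈commonFat⁺ h F'x F'y) F≢F') (∣commonFat∣≤1 x≉y)

  unpartnered-∣fatNbrs∣ : ∀ {x F F'} → ¬ Partnered x → F ≢ F' →
                          fatAdj h F x ≡ true → fatAdj h F' x ≡ true →
                          ∣ fatNbrs h F ∣ + ∣ fatNbrs h F' ∣ ≤ degree h x + 2
  unpartnered-∣fatNbrs∣ {x} {F} {F'} x-alone F≢F' Fx F'x = begin
    ∣ NF ∣ + ∣ NF' ∣                  ≡⟨ ∣p∪q∣+∣p∩q∣≡∣p∣+∣q∣ NF NF' ⟨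
    ∣ NF ∪ NF' ∣ + ∣ NF ∩ NF' ∣       ≤⟨ +-mono-≤ (p⊆q⇒∣p∣≤∣q∣ ∪⊆) (p⊆q⇒∣p∣≤∣q∣ ∩⊆) ⟩
    ∣ slimNbrs h x ∪ ⁅ x ⁆ ∣ + ∣ ⁅ x ⁆ ∣ ≤⟨ +-monoˡ-≤ ∣ ⁅ x ⁆ ∣ (∣p∪q∣≤∣p∣+∣q∣ (slimNbrs h x) ⁅ x ⁆) ⟩
    degree h x + ∣ ⁅ x ⁆ ∣ + ∣ ⁅ x ⁆ ∣  ≡⟨ cong (λ m → degree h x + m + m) (∣⁅x⁆∣≡1 x) ⟩
    degree h x + 1 + 1                ≡⟨ +-assoc (degree h x) 1 1 ⟩
    degree h x + 2                    ∎
    where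
    open ≤-Reasoning
    NF NF' : Subset s
    NF  = fatNbrs h F
    NF' = fatNbrs h F'

    apart : ∀ {y} → y ≢ x → part y ≢ part x
    apart y≢x y≈x = x-alone (_ , y≢x , y≈x)

    nbrOrSelf : ∀ {y G} → fatAdj h G x ≡ true → fatAdj h G y ≡ true → y ∈ slimNbrs h x ∪ ⁅ x ⁆
    nbrOrSelf {y} Gx Gy with y ≟ x
    ... | yes refl = x∈p∪q⁺ (inj₂ (x∈⁅x⁆ x))
    ... | no  y≢x  = x∈p∪q⁺ (inj₁ (∈-tabulate⁺ (apart-commonFat⇒adjacent (apart y≢x ∘ sym) Gx Gy)))

    ∪⊆ : NF ∪ NF' ⊆ slimNbrs h x ∪ ⁅ x ⁆
    ∪⊆ y∈∪ = [ nbrOrSelf Fx ∘ ∈-tabulate⁻ , nbrOrSelf F'x ∘ ∈-tabulate⁻ ]′ (x∈p∪q⁻ NF NF' y∈∪)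

    ∩⊆ : NF ∩ NF' ⊆ ⁅ x ⁆
    ∩⊆ {y} y∈∩ = Equivalence.from x∈⁅y⁆⇔x≡y $ decidable-stable (y ≟ x) λ y≢x →
      apart y≢x (twoCommonFat⇒samePart F≢F' (∈-tabulate⁻ y∈NF) Fx (∈-tabulate⁻ y∈NF') F'x)
      where y∈NF  = proj₁ (x∈p∩q⁻ NF NF' y∈∩)
            y∈NF' = proj₂ (x∈p∩q⁻ NF NF' y∈∩)

  partnered-∣fatNbrs∣ : ∀ {x F F'} → Partnered x → F ≢ F' →
                        fatAdj h F x ≡ true → fatAdj h F' x ≡ true →
                        degree h x + 3 ≤ ∣ fatNbrs h F ∣ + ∣ fatNbrs h F' ∣
  partnered-∣fatNbrs∣ {x} {F} {F'} x-partnered@(y , y≢x , y≈x) F≢F' Fx F'x = begin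
    degree h x + 3               ≡⟨ +-suc (degree h x) 2 ⟩
    suc (degree h x) + 2         ≤⟨ +-mono-≤ (p⊂q⇒∣p∣<∣q∣ nbrs⊂) (x,y∈p⇒1<∣p∣ x∈∩ y∈∩ (y≢x ∘ sym)) ⟩
    ∣ NF ∪ NF' ∣ + ∣ NF ∩ NF' ∣  ≡⟨ ∣p∪q∣+∣p∩q∣≡∣p∣+∣q∣ NF NF' ⟩
    ∣ NF ∣ + ∣ NF' ∣             ∎
    where
    open ≤-Reasoning
    NF NF' : Subset s
    NF  = fatNbrs h F
    NF' = fatNbrs h F'

    x∈∩ : x ∈ NF ∩ NF'
    x∈∩ = x∈p∩q⁺ (∈-tabulate⁺ Fx , ∈-tabulate⁺ F'x)

    y∈∩ : y ∈ NF ∩ NF'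
    y∈∩ = x∈p∩q⁺ (∈-tabulate⁺ (samePart⇒fatAdj y≈x Fx) , ∈-tabulate⁺ (samePart⇒fatAdj y≈x F'x))

    nbrs⊆ : slimNbrs h x ⊆ NF ∪ NF'
    nbrs⊆ {z} z∈ with part z ≟ part x
    ... | yes z≈x = x∈p∪q⁺ (inj₁ (∈-tabulate⁺ (samePart⇒fatAdj z≈x Fx)))
    ... | no  z≉x with apart-adjacent⇒commonFat (z≉x ∘ sym) (∈-tabulate⁻ z∈)
    ...   | G , Gx , Gz with fatIndexing₂⇒≡⊎≡ (partnered⇒fatIndexing₂ x-partnered) F≢F' Fx F'x Gx
    ...     | inj₁ refl = x∈p∪q⁺ (inj₁ (∈-tabulate⁺ Gz))
    ...     | inj₂ refl = x∈p∪q⁺ (inj₂ (∈-tabulate⁺ Gz))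

    nbrs⊂ : slimNbrs h x ⊂ NF ∪ NF'
    nbrs⊂ = nbrs⊆ , x , x∈p∪q⁺ (inj₁ (∈-tabulate⁺ Fx)) ,
            λ x∈ → contradiction (trans (sym (∈-tabulate⁻ x∈)) (slimIrrefl h x)) λ ()

-- Common neighbours of two non-adjacent slim vertices

module CommonNeighbours {s} {h : Hoffman s} (D : H3DDecomposition h)
                        {u v : Fin s} (u≢v : u ≢ v) (u≁v : slimAdj h u v ≡ false) where
  open H3DDecomposition D
  open Decomposition D

  common : Subset s
  common = commonSlimNbrs h u v

  part-u≢part-v : part u ≢ part v
  part-u≢part-v u≈v = contradiction (trans (sym (samePart⇒adjacent u≈v u≢v)) u≁v) λ ()

  uFat≢vFat : ∀ {A B} → fatAdj h A u ≡ true → fatAdj h B v ≡ true → A ≢ B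
  uFat≢vFat Au Bv refl = apart-nonadjacent⇒noCommonFat part-u≢part-v u≁v Au Bv

  module _ {w} (w∈C : w ∈ common) where

    private
      u∼w×v∼w = ∈-tabulate-∧⁻ {p = slimAdj h u} {q = slimAdj h v} w∈C

      part-u≢part-w : part u ≢ part w
      part-u≢part-w u≈w =
        let F , Fw , Fv = apart-adjacent⇒commonFat (part-u≢part-v ∘ trans u≈w)
                            (trans (slimSym h w v) (proj₂ u∼w×v∼w))
        in uFat≢vFat (samePart⇒fatAdj u≈w Fw) Fv refl

      part-v≢part-w : part v ≢ part w
      part-v≢part-w v≈w =
        let F , Fw , Fu = apart-adjacent⇒commonFat (part-u≢part-v ∘ sym ∘ trans v≈w)
                            (trans (slimSym h w u) (proj₁ u∼w×v∼w))
        in uFat≢vFat Fu (samePart⇒fatAdj v≈w Fw) refl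

      uFat×adj = apart-adjacent⇒commonFat part-u≢part-w (proj₁ u∼w×v∼w)
      vFat×adj = apart-adjacent⇒commonFat part-v≢part-w (proj₂ u∼w×v∼w)

    uFat : Fin (fat h)
    uFat = proj₁ uFat×adj

    uFat-u : fatAdj h uFat u ≡ true
    uFat-u = proj₁ (proj₂ uFat×adj)

    uFat-w : fatAdj h uFat w ≡ true
    uFat-w = proj₂ (proj₂ uFat×adj)

    vFat : Fin (fat h)
    vFat = proj₁ vFat×adj

    vFat-v : fatAdj h vFat v ≡ true
    vFat-v = proj₁ (proj₂ vFat×adj)

    vFat-w : fatAdj h vFat w ≡ true
    vFat-w = proj₂ (proj₂ vFat×adj)

  sameFats⇒samePart : ∀ {w w'} (w∈C : w ∈ common) (w'∈C : w' ∈ common) →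
                      uFat w∈C ≡ uFat w'∈C → vFat w∈C ≡ vFat w'∈C → part w ≡ part w'
  sameFats⇒samePart {w' = w'} w∈C w'∈C uFat≡ vFat≡ =
    twoCommonFat⇒samePart (uFat≢vFat (uFat-u w∈C) (vFat-v w∈C))
      (uFat-w w∈C) (subst (λ F → fatAdj h F w' ≡ true) (sym uFat≡) (uFat-w w'∈C))
      (vFat-w w∈C) (subst (λ F → fatAdj h F w' ≡ true) (sym vFat≡) (vFat-w w'∈C))

  module Cells {k l} (Iu : FatIndexing h u k) (Iv : FatIndexing h v l) where

    row : ∀ {w} → w ∈ common → Fin k
    row w∈C = index Iu (uFat-u w∈C)

    column : ∀ {w} → w ∈ common → Fin l
    column w∈C = index Iv (vFat-v w∈C)

    module _ {w w'} (w∈C : w ∈ common) (w'∈C : w' ∈ common) where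

      row-injective : row w∈C ≡ row w'∈C → uFat w∈C ≡ uFat w'∈C
      row-injective = index-injective Iu (uFat-u w∈C) (uFat-u w'∈C)

      column-injective : column w∈C ≡ column w'∈C → vFat w∈C ≡ vFat w'∈C
      column-injective = index-injective Iv (vFat-v w∈C) (vFat-v w'∈C)

      sameCell⇒samePart : row w∈C ≡ row w'∈C → column w∈C ≡ column w'∈C → part w ≡ part w'
      sameCell⇒samePart row≡ column≡ =
        sameFats⇒samePart w∈C w'∈C (row-injective row≡) (column-injective column≡)

    cellInjective : CellInjective row column slot
    cellInjective w∈C w'∈C row≡ column≡ = slot-injective (sameCell⇒samePart w∈C w'∈C row≡ column≡)

  ∣common∣≤ : ∀ {k l} → FatIndexing h u k → FatIndexing h v l → ∣ common ∣ ≤ k * l * 2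
  ∣common∣≤ Iu Iv = cellInjective⇒∣S∣≤ (Cells.cellInjective Iu Iv)

  ∣common∣≤18 : ∣ common ∣ ≤ 18
  ∣common∣≤18 = ∣common∣≤ (fatIndexing₃ u) (fatIndexing₃ v)

  module Regular {k} (regular : ∀ x → degree h x ≡ k) where
    open Cells (fatIndexing₃ u) (fatIndexing₃ v)

    Heavy : Fin (fat h) → Fin (fat h) → Set
    Heavy A B = fatAdj h A u ≡ true × fatAdj h B v ≡ true ×
                ∃[ x ] (Partnered x × fatAdj h A x ≡ true × fatAdj h B x ≡ true)

    heavy? : ∀ A B → Dec (Heavy A B)
    heavy? A B = fatAdj h A u ≟ᵇ true ×-dec fatAdj h B v ≟ᵇ true ×-dec
                 any? λ x → partnered? x ×-dec fatAdj h A x ≟ᵇ true ×-dec fatAdj h B x ≟ᵇ true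

    sameCell⇒heavy : ∀ {w w'} (w∈C : w ∈ common) (w'∈C : w' ∈ common) → w ≢ w' →
                     row w∈C ≡ row w'∈C → column w∈C ≡ column w'∈C → Heavy (uFat w∈C) (vFat w∈C)
    sameCell⇒heavy {w' = w'} w∈C w'∈C w≢w' row≡ column≡ =
      uFat-u w∈C , vFat-v w∈C , _ ,
      (w' , w≢w' ∘ sym , sym (sameCell⇒samePart w∈C w'∈C row≡ column≡)) , uFat-w w∈C , vFat-w w∈C

    heavy⇒k+3≤ : ∀ {A B} → Heavy A B → k + 3 ≤ ∣ fatNbrs h A ∣ + ∣ fatNbrs h B ∣
    heavy⇒k+3≤ (Au , Bv , x , x-partnered , Ax , Bx) =
      subst (λ d → d + 3 ≤ _) (regular x) (partnered-∣fatNbrs∣ x-partnered (uFat≢vFat Au Bv) Ax Bx)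

    unpartnered⇒≤k+2 : ∀ {x A A'} → ¬ Partnered x → A ≢ A' →
                       fatAdj h A x ≡ true → fatAdj h A' x ≡ true → ∣ fatNbrs h A ∣ + ∣ fatNbrs h A' ∣ ≤ k + 2
    unpartnered⇒≤k+2 {x} x-alone A≢A' Ax A'x =
      subst (λ d → _ ≤ d + 2) (regular x) (unpartnered-∣fatNbrs∣ x-alone A≢A' Ax A'x)

    heavy-meeting : ¬ Partnered u → ¬ Partnered v → Meeting {R = Heavy}
    heavy-meeting u-alone v-alone {A} {B} {A'} {B'} AB@(Au , Bv , _) A'B'@(A'u , B'v , _)
      with A ≟ A' | B ≟ B'
    ... | yes A≡A' | _        = inj₁ A≡A'
    ... | no  _    | yes B≡B' = inj₂ B≡B'
    ... | no  A≢A' | no  B≢B' = ⊥-elim $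
      crossSums-contradiction (∣ fatNbrs h A ∣) (∣ fatNbrs h B ∣) (∣ fatNbrs h A' ∣) (∣ fatNbrs h B' ∣)
        (heavy⇒k+3≤ AB) (heavy⇒k+3≤ A'B')
        (unpartnered⇒≤k+2 u-alone A≢A' Au A'u) (unpartnered⇒≤k+2 v-alone B≢B' Bv B'v)

    ∣common∣≤12-unpartnered : ¬ Partnered u → ¬ Partnered v → ∣ common ∣ ≤ 12
    ∣common∣≤12-unpartnered u-alone v-alone with any? (λ A → any? λ B → heavy? A B)
    ... | no ∄heavy =
      cellInjective⇒∣S∣≤-oneFullRow cellInjective zero λ w∈C w'∈C w≢w' row≡ column≡ →
        ⊥-elim (∄heavy (_ , _ , sameCell⇒heavy w∈C w'∈C w≢w' row≡ column≡))
    ... | yes (_ , _ , heavy₀@(A₀u , B₀v , _))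
      with meeting⇒sharedRow⊎sharedColumn heavy? (heavy-meeting u-alone v-alone)
    ...   | inj₁ sharedRow =
      cellInjective⇒∣S∣≤-oneFullRow cellInjective (index (fatIndexing₃ u) A₀u)
        λ w∈C w'∈C w≢w' row≡ column≡ →
          index-cong (fatIndexing₃ u) (sharedRow (sameCell⇒heavy w∈C w'∈C w≢w' row≡ column≡) heavy₀) _ _
    ...   | inj₂ sharedColumn =
      cellInjective⇒∣S∣≤-oneFullRow (CellInjective-swap cellInjective) (index (fatIndexing₃ v) B₀v)
        λ w∈C w'∈C w≢w' column≡ row≡ →
          index-cong (fatIndexing₃ v) (sharedColumn (sameCell⇒heavy w∈C w'∈C w≢w' row≡ column≡) heavy₀) _ _

  ∣common∣≤12 : ∀ {k} → (∀ x → degree h x ≡ k) → ∣ common ∣ ≤ 12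
  ∣common∣≤12 regular with partnered? u | partnered? v
  ... | yes u-partnered | _               = ∣common∣≤ (partnered⇒fatIndexing₂ u-partnered) (fatIndexing₃ v)
  ... | no  _           | yes v-partnered = ∣common∣≤ (fatIndexing₃ u) (partnered⇒fatIndexing₂ v-partnered)
  ... | no  u-alone     | no  v-alone     = Regular.∣common∣≤12-unpartnered regular u-alone v-alone

corollary3p4 : (c q : ℕ) → c ≥ 1 → q ≥ 1 → (n : ℕ) → (G : Graph n) →
    MuBounded G c → AssocIs2Fat G q → AssocIsH3DLine G q →
    (∀ u v → u ≢ v → adj G u v ≡ false → ∣ commonNbrs G u v ∣ ≤ 18) ×
    (Regular G → ∀ u v → u ≢ v → adj G u v ≡ false → ∣ commonNbrs G u v ∣ ≤ 12)
corollary3p4 _ _ _ _ _ G _ _ (h , slim≡adj , _ , D) =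
  (λ u v u≢v u≁v → ≤-trans (≤-reflexive (∣commonNbrs∣≡ u v)) (∣common∣≤18 D u≢v (slim≡false u≁v))) ,
  (λ (k , regular) u v u≢v u≁v → ≤-trans (≤-reflexive (∣commonNbrs∣≡ u v))
     (∣common∣≤12 D u≢v (slim≡false u≁v) λ x → trans (cong ∣_∣ (tabulate-cong (slim≡adj x))) (regular x)))
  where
  open CommonNeighbours using (∣common∣≤18; ∣common∣≤12)

  slim≡false : ∀ {u v} → adj G u v ≡ false → slimAdj h u v ≡ false
  slim≡false {u} {v} = trans (slim≡adj u v)

  ∣commonNbrs∣≡ : ∀ u v → ∣ commonNbrs G u v ∣ ≡ ∣ commonSlimNbrs h u v ∣
  ∣commonNbrs∣≡ u v = cong ∣_∣ (tabulate-cong λ w → sym (cong₂ _∧_ (slim≡adj u w) (slim≡adj v w)))
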